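{- Let $f \in \mathcal{G}$. Then $\operatorname{Part} f$ is decidable if and only if $f$ is effectively conjugate to its normal form $f'$ (i.e. $f'$ is recursive and there is $h \in \mathcal{G}$ with $f = h^{ -1} f' h$). Moreover, a decider for $\operatorname{Part} f$ can be computed from (a program for) $f'$.
   Context: $\mathcal{G}$ denotes the group of recursive permutations of $\mathbb{N}$. For a permutation $f$, $[x]_f = \{f^k(x): k\in\mathbb{Z}\}$ is its cycle containing $x$ and $\operatorname{Part} f = \{[x]_f : x \in \mathbb{N}\}$; $\operatorname{Part} f$ is decidable if there is a total recursive function deciding, for all $x,x'$, whether $x' \in [x]_f$. Let $\delta:\mathbb{Z}\to\mathbb{N}$ be the bijection $\delta(0)=0$, $\delta(k) = 2k$ for $k>0$, $\delta(k) = -2k-1$ for $k<0$. A cycle of a permutation $f$ of length $n \in \mathbb{N}^+ \cup\{\infty\}$ with least element $a_0$ is in normal form if $j \mapsto f^{\delta^{ -1}(j)}(a_0)$ is strictly increasing for $0 \le j < n$; a permutation is normal if all its cycles are in normal form. For every permutation $f$ there is exactly one (possibly non-recursive) normal permutation $f'$ with $\operatorname{Part} f' = \operatorname{Part} f$, called the normal form of $f$. Effective conjugacy means conjugacy via an element of $\mathcal{G}$. -}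

module Defs where

open import Data.Nat using (ℕ; zero; suc; _+_; _<_; _≤_)
open import Data.Integer using (ℤ; +_; -[1+_])
open import Data.Product using (Σ; _×_; _,_; ∃)
open import Data.Sum using (_⊎_)
open import Relation.Nullary using (¬_)
open import Relation.Binary.PropositionalEquality using (_≡_; _≢_)
open import Function.Bundles using (_⇔_)

tri : ℕ → ℕ
tri zero    = 0
tri (suc n) = suc n + tri n

⟪_,_⟫ : ℕ → ℕ → ℕ
⟪ x , y ⟫ = tri (x + y) + y

-- Program codes (indices) are natural numbers of the form ⟪ tag , arg ⟫:
--   ⟪0,0⟫ zero     ⟪1,0⟫ successor   ⟪2,0⟫ first projection of a pair
--   ⟪3,0⟫ second projection           ⟪4,0⟫ identity
--   ⟪5,⟪a,b⟫⟫ composition  x ↦ b (a x)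
--   ⟪6,⟪a,b⟫⟫ pairing      x ↦ ⟪ a x , b x ⟫
--   ⟪7,⟪a,b⟫⟫ primitive recursion on the second pair component
--   ⟪8,a⟫     unbounded minimisation  x ↦ μn. a ⟪x,n⟫ = 0
-- Eval e x y : program e on input x halts with output y.
data Eval : ℕ → ℕ → ℕ → Set where
  ev-zero : ∀ {x} → Eval ⟪ 0 , 0 ⟫ x 0
  ev-succ : ∀ {x} → Eval ⟪ 1 , 0 ⟫ x (suc x)
  ev-fst  : ∀ {x y} → Eval ⟪ 2 , 0 ⟫ ⟪ x , y ⟫ x
  ev-snd  : ∀ {x y} → Eval ⟪ 3 , 0 ⟫ ⟪ x , y ⟫ y
  ev-id   : ∀ {x} → Eval ⟪ 4 , 0 ⟫ x x
  ev-comp : ∀ {a b x y z} → Eval a x y → Eval b y z → Eval ⟪ 5 , ⟪ a , b ⟫ ⟫ x z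
  ev-pair : ∀ {a b x y z} → Eval a x y → Eval b x z → Eval ⟪ 6 , ⟪ a , b ⟫ ⟫ x ⟪ y , z ⟫
  ev-rec0 : ∀ {a b x y} → Eval a x y → Eval ⟪ 7 , ⟪ a , b ⟫ ⟫ ⟪ x , 0 ⟫ y
  ev-recS : ∀ {a b x n r y} → Eval ⟪ 7 , ⟪ a , b ⟫ ⟫ ⟪ x , n ⟫ r →
            Eval b ⟪ x , ⟪ n , r ⟫ ⟫ y → Eval ⟪ 7 , ⟪ a , b ⟫ ⟫ ⟪ x , suc n ⟫ y
  ev-mu   : ∀ {a x n} → Eval a ⟪ x , n ⟫ 0 →
            (∀ i → i < n → Σ ℕ λ v → Eval a ⟪ x , i ⟫ (suc v)) →
            Eval ⟪ 8 , a ⟫ x n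

Computes : ℕ → (ℕ → ℕ) → Set
Computes e f = ∀ x → Eval e x (f x)

Recursive : (ℕ → ℕ) → Set
Recursive f = ∃ λ e → Computes e f

record Perm : Set where
  field
    fun     : ℕ → ℕ
    inv     : ℕ → ℕ
    inv-fun : ∀ x → inv (fun x) ≡ x
    fun-inv : ∀ x → fun (inv x) ≡ x
open Perm public

InG : Perm → Set
InG p = Recursive (fun p)

iter : (ℕ → ℕ) → ℕ → ℕ → ℕ
iter g zero    x = x
iter g (suc n) x = g (iter g n x)

pow : Perm → ℤ → ℕ → ℕ
pow p (+ n)      x = iter (fun p) n x
pow p -[1+ n ]   x = iter (inv p) (suc n) x

SameCycle : Perm → ℕ → ℕ → Set
SameCycle p x x' = ∃ λ (k : ℤ) → pow p k x ≡ x'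

SamePart : Perm → Perm → Set
SamePart p q = ∀ x x' → SameCycle p x x' ⇔ SameCycle q x x'

DecidesPart : Perm → ℕ → Set
DecidesPart p d = ∀ x x' →
  (Eval d ⟪ x , x' ⟫ 1 × SameCycle p x x') ⊎ (Eval d ⟪ x , x' ⟫ 0 × ¬ SameCycle p x x')

PartDecidable : Perm → Set
PartDecidable p = ∃ λ d → DecidesPart p d

-- δ⁻¹ : ℕ → ℤ, inverse of δ(0)=0, δ(k)=2k (k>0), δ(k)=-2k-1 (k<0)
growℤ : ℤ → ℤ
growℤ (+ m)     = + suc m
growℤ -[1+ m ]  = -[1+ suc m ]

δinv : ℕ → ℤ
δinv zero          = + 0
δinv (suc zero)    = -[1+ 0 ]
δinv (suc (suc n)) = growℤ (δinv n)

CycleLengthGreater : Perm → ℕ → ℕ → Set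
CycleLengthGreater p a m = ∀ i → 1 ≤ i → i ≤ m → iter (fun p) i a ≢ a

LeastInCycle : Perm → ℕ → Set
LeastInCycle p a = ∀ y → SameCycle p a y → a ≤ y

-- the cycle with least element a₀ is in normal form:
-- j ↦ f^{δ⁻¹ j}(a₀) strictly increasing for 0 ≤ j < n (n = cycle length)
CycleNormal : Perm → ℕ → Set
CycleNormal p a₀ = ∀ j → CycleLengthGreater p a₀ (suc j) →
  pow p (δinv j) a₀ < pow p (δinv (suc j)) a₀

IsNormal : Perm → Set
IsNormal p = ∀ a₀ → LeastInCycle p a₀ → CycleNormal p a₀

module Submission where

-- If Part f is decidable, the least element of every cycle and the rank of every y in its
-- cycle (the number of smaller elements of that cycle) are computable. So is the bijection g
-- sending the element of rank i of a cycle to the i-th element a, f⁻¹ a, f a, f⁻² a, f² a, …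
-- listed from its least element a, and so is its inverse h, found by search; h f h⁻¹ is then
-- the normal form. Conversely, in a normal permutation the i-th listed element of a cycle is
-- at least i, so x' lies in the cycle of x exactly when f'ᵏ x = x' or f'ᵏ x' = x for some
-- k ≤ x + x'. A bounded search with a program for f' decides this, uniformly in the program.

open import Defs
open import Data.Nat
  using ( ℕ; zero; suc; _+_; _*_; _∸_; _≤_; _<_; z≤n; s≤s; s≤s⁻¹; pred; _%_; _/_; NonZero
        ; ⌊_/2⌋; ⌈_/2⌉; ∣_-_∣; _≟_; _≤?_; _<?_)
open import Data.Nat.Properties
open import Data.Nat.DivMod using (m≡m%n+[m/n]*n; m%n<n)
open import Data.Nat.GeneralisedArithmetic using (fold)
open import Data.Nat.Induction using (<-rec)
open import Data.Nat.ListAction using (sum)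
open import Data.Integer using (ℤ; +_; -[1+_])
open import Data.Product using (Σ; _×_; ∃; _,_; proj₁; proj₂)
open import Data.Sum using (_⊎_; inj₁; inj₂; [_,_]′)
open import Data.Empty using (⊥; ⊥-elim)
open import Data.List using (List; []; _∷_; length; _++_; filter; downFrom; applyDownFrom)
open import Data.List.Properties using (length-++; length-applyDownFrom)
open import Data.List.Membership.Propositional using (_∈_)
open import Data.List.Membership.Propositional.Properties
  using ( ∈-∃++; ∈-++⁻; ∈-++⁺ˡ; ∈-++⁺ʳ; ∈-filter⁺; ∈-filter⁻; ∈-downFrom⁺; ∈-downFrom⁻
        ; ∈-applyDownFrom⁺; ∈-applyDownFrom⁻)
open import Data.List.Relation.Unary.Any using (here; there)
import Data.List.Relation.Unary.All as All
open import Data.List.Relation.Unary.AllPairs using (_∷_)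
open import Data.List.Relation.Unary.Unique.Propositional using (Unique)
import Data.List.Relation.Unary.Unique.Propositional.Properties as Unique
open import Data.List.Relation.Binary.Subset.Propositional using (_⊆_)
open import Relation.Nullary using (¬_; Dec; yes; no)
open import Relation.Nullary.Decidable using (_×-dec_)
open import Relation.Binary.PropositionalEquality
open import Relation.Binary.Definitions using (Tri; tri<; tri≈; tri>)
open import Function.Bundles using (_⇔_; Equivalence; mk⇔)

-- Pairing is opaque so that codes and encoded inputs keep the shape ⦅ a , b ⦆
-- during unification instead of unfolding into Cantor-pairing arithmetic.
opaque
  ⦅_,_⦆ : ℕ → ℕ → ℕ
  ⦅ a , b ⦆ = ⟪ a , b ⟫

  ⦅,⦆≡⟪,⟫ : ∀ a b → ⦅ a , b ⦆ ≡ ⟪ a , b ⟫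
  ⦅,⦆≡⟪,⟫ a b = refl

  eval-zero : ∀ {x} → Eval ⦅ 0 , 0 ⦆ x 0
  eval-zero = ev-zero
  eval-succ : ∀ {x} → Eval ⦅ 1 , 0 ⦆ x (suc x)
  eval-succ = ev-succ
  eval-fst : ∀ {x y} → Eval ⦅ 2 , 0 ⦆ ⦅ x , y ⦆ x
  eval-fst {x} {y} = ev-fst {x} {y}
  eval-snd : ∀ {x y} → Eval ⦅ 3 , 0 ⦆ ⦅ x , y ⦆ y
  eval-snd {x} {y} = ev-snd {x} {y}
  eval-id : ∀ {x} → Eval ⦅ 4 , 0 ⦆ x x
  eval-id = ev-id
  eval-comp : ∀ {a b x y z} → Eval a x y → Eval b y z → Eval ⦅ 5 , ⦅ a , b ⦆ ⦆ x z
  eval-comp = ev-comp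
  eval-pair : ∀ {a b x y z} → Eval a x y → Eval b x z → Eval ⦅ 6 , ⦅ a , b ⦆ ⦆ x ⦅ y , z ⦆
  eval-pair {a} {b} {x} {y} {z} = ev-pair {a} {b} {x} {y} {z}
  eval-rec0 : ∀ {a b x y} → Eval a x y → Eval ⦅ 7 , ⦅ a , b ⦆ ⦆ ⦅ x , 0 ⦆ y
  eval-rec0 {a} {b} {x} {y} = ev-rec0 {a} {b} {x} {y}
  eval-recS : ∀ {a b x n r y} → Eval ⦅ 7 , ⦅ a , b ⦆ ⦆ ⦅ x , n ⦆ r →
              Eval b ⦅ x , ⦅ n , r ⦆ ⦆ y → Eval ⦅ 7 , ⦅ a , b ⦆ ⦆ ⦅ x , suc n ⦆ y
  eval-recS {a} {b} {x} {n} {r} {y} = ev-recS {a} {b} {x} {n} {r} {y}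
  eval-μ : ∀ {a x n} → Eval a ⦅ x , n ⦆ 0 →
           (∀ i → i < n → Σ ℕ λ v → Eval a ⦅ x , i ⦆ (suc v)) → Eval ⦅ 8 , a ⦆ x n
  eval-μ {a} {x} {n} = ev-mu {a} {x} {n}

zeroᵖ succᵖ fstᵖ sndᵖ idᵖ : ℕ
zeroᵖ = ⦅ 0 , 0 ⦆
succᵖ = ⦅ 1 , 0 ⦆
fstᵖ  = ⦅ 2 , 0 ⦆
sndᵖ  = ⦅ 3 , 0 ⦆
idᵖ   = ⦅ 4 , 0 ⦆

infixl 5 _▹_
_▹_ ⟨_,_⟩ᵖ recᵖ : ℕ → ℕ → ℕ
a ▹ b       = ⦅ 5 , ⦅ a , b ⦆ ⦆
⟨ a , b ⟩ᵖ  = ⦅ 6 , ⦅ a , b ⦆ ⦆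
recᵖ a b    = ⦅ 7 , ⦅ a , b ⦆ ⦆

μᵖ : ℕ → ℕ
μᵖ a = ⦅ 8 , a ⦆

constᵖ : ℕ → ℕ
constᵖ zero    = zeroᵖ
constᵖ (suc k) = constᵖ k ▹ succᵖ

record Realises {X Y : Set} (ex : X → ℕ) (ey : Y → ℕ) (t : ℕ) (F : X → Y) : Set where
  constructor realise
  field run : ∀ x → Eval t (ex x) (ey (F x))
open Realises public

nat : ℕ → ℕ
nat x = x

infixr 5 _⊗_
_⊗_ : {X Y : Set} → (X → ℕ) → (Y → ℕ) → X × Y → ℕ
(ex ⊗ ey) (x , y) = ⦅ ex x , ey y ⦆

primRec : {X Y : Set} → (X → Y) → (X × ℕ × Y → Y) → X × ℕ → Y
primRec A B (x , zero)  = A x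
primRec A B (x , suc n) = B (x , n , primRec A B (x , n))

private variable
  X Y Z : Set
  ex : X → ℕ
  ey : Y → ℕ
  ez : Z → ℕ

Realises-cong : ∀ {X Y : Set} {ex : X → ℕ} {ey : Y → ℕ} {t} {F G : X → Y} →
                (∀ x → F x ≡ G x) → Realises ex ey t F → Realises ex ey t G
Realises-cong {ex = ex} {ey} {t} F≗G r =
  realise λ x → subst (λ v → Eval t (ex x) (ey v)) (F≗G x) (run r x)

zeroᴿ : Realises ex nat zeroᵖ (λ _ → 0)
zeroᴿ = realise λ _ → eval-zero

idᴿ : Realises ex ex idᵖ (λ x → x)
idᴿ = realise λ _ → eval-id

fstᴿ : Realises (ex ⊗ ey) ex fstᵖ proj₁
fstᴿ = realise λ _ → eval-fst

sndᴿ : Realises (ex ⊗ ey) ey sndᵖ proj₂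
sndᴿ = realise λ _ → eval-snd

▹ᴿ : ∀ {a b} {F : X → Y} {G : Y → Z} →
     Realises ex ey a F → Realises ey ez b G → Realises ex ez (a ▹ b) (λ x → G (F x))
▹ᴿ {F = F} ra rb = realise λ x → eval-comp (run ra x) (run rb (F x))

pairᴿ : ∀ {a b} {F : X → Y} {G : X → Z} →
        Realises ex ey a F → Realises ex ez b G → Realises ex (ey ⊗ ez) ⟨ a , b ⟩ᵖ (λ x → F x , G x)
pairᴿ ra rb = realise λ x → eval-pair (run ra x) (run rb x)

recᴿ : ∀ {X Y : Set} {ex : X → ℕ} {ey : Y → ℕ} {a b} {A : X → Y} {B : X × ℕ × Y → Y} →
       Realises ex ey a A → Realises (ex ⊗ nat ⊗ ey) ey b B → Realises (ex ⊗ nat) ey (recᵖ a b) (primRec A B)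
recᴿ {ex = ex} {ey} {a} {b} {A} {B} ra rb = realise λ (x , n) → go x n
  where
  go : ∀ x n → Eval (recᵖ a b) ⦅ ex x , n ⦆ (ey (primRec A B (x , n)))
  go x zero    = eval-rec0 (run ra x)
  go x (suc n) = eval-recS (go x n) (run rb (x , n , primRec A B (x , n)))

μᴿ : ∀ {a} {T : X × ℕ → ℕ} → Realises (ex ⊗ nat) nat a T → (N : X → ℕ) →
     (∀ x → T (x , N x) ≡ 0) → (∀ x i → i < N x → T (x , i) ≢ 0) → Realises ex nat (μᵖ a) N
μᴿ {a = a} ra N vanishes nonzero = realise λ x →
  eval-μ (subst (Eval a _) (vanishes x) (run ra (x , N x))) (λ i i<N → positive (run ra (x , i)) (nonzero x i i<N))
  where
  positive : ∀ {u v} → Eval a u v → v ≢ 0 → Σ ℕ λ w → Eval a u (suc w)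
  positive {v = zero}  _ v≢0 = ⊥-elim (v≢0 refl)
  positive {v = suc w} e _   = w , e

succᴿ : Realises nat nat succᵖ suc
succᴿ = realise λ _ → eval-succ

constᴿ : ∀ k → Realises ex nat (constᵖ k) (λ _ → k)
constᴿ zero    = zeroᴿ
constᴿ (suc k) = ▹ᴿ (constᴿ k) succᴿ

iterᵖ : ℕ → ℕ
iterᵖ p = recᵖ idᵖ (sndᵖ ▹ sndᵖ ▹ p)

addᵖ predᵖ monusᵖ distᵖ isZeroᵖ eqᵖ signᵖ ifZeroᵖ halvesᵖ : ℕ
addᵖ    = iterᵖ succᵖ
predᵖ   = ⟨ zeroᵖ , idᵖ ⟩ᵖ ▹ recᵖ zeroᵖ (sndᵖ ▹ fstᵖ)
monusᵖ  = iterᵖ predᵖ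
distᵖ   = ⟨ monusᵖ , ⟨ sndᵖ , fstᵖ ⟩ᵖ ▹ monusᵖ ⟩ᵖ ▹ addᵖ
isZeroᵖ = ⟨ constᵖ 1 , idᵖ ⟩ᵖ ▹ monusᵖ
eqᵖ     = distᵖ ▹ isZeroᵖ
signᵖ   = isZeroᵖ ▹ isZeroᵖ
ifZeroᵖ = recᵖ fstᵖ (fstᵖ ▹ sndᵖ)
halvesᵖ = ⟨ ⟨ zeroᵖ , zeroᵖ ⟩ᵖ , idᵖ ⟩ᵖ ▹ iterᵖ ⟨ sndᵖ , fstᵖ ▹ succᵖ ⟩ᵖ

ifZero : ℕ → ℕ → ℕ → ℕ
ifZero zero    u v = u
ifZero (suc _) u v = v

thirdᴿ : Realises (ex ⊗ nat ⊗ ey) ey (sndᵖ ▹ sndᵖ) (λ (_ , _ , r) → r)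
thirdᴿ {ey = ey} = ▹ᴿ {ey = nat ⊗ ey} sndᴿ sndᴿ

foldᴿ : ∀ {p} {F : X → X} → Realises ex ex p F → Realises (ex ⊗ nat) ex (iterᵖ p) (λ (x , n) → fold x F n)
foldᴿ {F = F} rp = Realises-cong (λ (x , n) → primRec-fold x n) (recᴿ idᴿ (▹ᴿ thirdᴿ rp))
  where
  primRec-fold : ∀ x n → primRec (λ x → x) (λ (_ , _ , r) → F r) (x , n) ≡ fold x F n
  primRec-fold x zero    = refl
  primRec-fold x (suc n) = cong F (primRec-fold x n)

fold≡iter : ∀ (F : ℕ → ℕ) x n → fold x F n ≡ iter F n x
fold≡iter F x zero    = refl
fold≡iter F x (suc n) = cong F (fold≡iter F x n)

iterᴿ : ∀ {p} {F : ℕ → ℕ} → Realises nat nat p F →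
        Realises (nat ⊗ nat) nat (iterᵖ p) (λ (x , n) → iter F n x)
iterᴿ {F = F} rp = Realises-cong (λ (x , n) → fold≡iter F x n) (foldᴿ rp)

addᴿ : Realises (nat ⊗ nat) nat addᵖ (λ (m , n) → m + n)
addᴿ = Realises-cong (λ (m , n) → trans (iter-suc m n) (+-comm n m)) (iterᴿ succᴿ)
  where
  iter-suc : ∀ m n → iter suc n m ≡ n + m
  iter-suc m zero    = refl
  iter-suc m (suc n) = cong suc (iter-suc m n)

predᴿ : Realises nat nat predᵖ pred
predᴿ = Realises-cong (λ { zero → refl ; (suc _) → refl })
          (▹ᴿ (pairᴿ zeroᴿ idᴿ) (recᴿ zeroᴿ (▹ᴿ {ey = nat ⊗ nat} sndᴿ fstᴿ)))

monusᴿ : Realises (nat ⊗ nat) nat monusᵖ (λ (m , n) → m ∸ n)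
monusᴿ = Realises-cong (λ (m , n) → iter-pred m n) (iterᴿ predᴿ)
  where
  iter-pred : ∀ m n → iter pred n m ≡ m ∸ n
  iter-pred m zero    = refl
  iter-pred m (suc n) = trans (cong pred (iter-pred m n)) (pred[m∸n]≡m∸[1+n] m n)

m∸n+n∸m≡∣m-n∣ : ∀ m n → (m ∸ n) + (n ∸ m) ≡ ∣ m - n ∣
m∸n+n∸m≡∣m-n∣ zero    zero    = refl
m∸n+n∸m≡∣m-n∣ zero    (suc n) = refl
m∸n+n∸m≡∣m-n∣ (suc m) zero    = +-identityʳ (suc m)
m∸n+n∸m≡∣m-n∣ (suc m) (suc n) = m∸n+n∸m≡∣m-n∣ m n

distᴿ : Realises (nat ⊗ nat) nat distᵖ (λ (m , n) → ∣ m - n ∣)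
distᴿ = Realises-cong (λ (m , n) → m∸n+n∸m≡∣m-n∣ m n)
          (▹ᴿ (pairᴿ monusᴿ (▹ᴿ (pairᴿ sndᴿ fstᴿ) monusᴿ)) addᴿ)

isZeroᴿ : Realises nat nat isZeroᵖ (1 ∸_)
isZeroᴿ = ▹ᴿ (pairᴿ (constᴿ 1) idᴿ) monusᴿ

eqᴿ : Realises (nat ⊗ nat) nat eqᵖ (λ (m , n) → 1 ∸ ∣ m - n ∣)
eqᴿ = ▹ᴿ distᴿ isZeroᴿ

signᴿ : Realises nat nat signᵖ (λ n → 1 ∸ (1 ∸ n))
signᴿ = ▹ᴿ isZeroᴿ isZeroᴿ

ifZeroᴿ : Realises ((nat ⊗ nat) ⊗ nat) nat ifZeroᵖ (λ ((u , v) , n) → ifZero n u v)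
ifZeroᴿ = Realises-cong (λ { (_ , zero) → refl ; (_ , suc _) → refl })
            (recᴿ fstᴿ (▹ᴿ {ey = nat ⊗ nat} fstᴿ sndᴿ))

halvesᴿ : Realises nat (nat ⊗ nat) halvesᵖ (λ n → ⌊ n /2⌋ , ⌈ n /2⌉)
halvesᴿ = Realises-cong halves
  (▹ᴿ (pairᴿ (pairᴿ zeroᴿ zeroᴿ) idᴿ) (foldᴿ (pairᴿ sndᴿ (▹ᴿ fstᴿ succᴿ))))
  where
  halves : ∀ n → fold (0 , 0) (λ (a , b) → b , suc a) n ≡ (⌊ n /2⌋ , ⌈ n /2⌉)
  halves zero    = refl
  halves (suc n) = cong (λ (a , b) → b , suc a) (halves n)

inverseᵖ : ℕ → ℕ
inverseᵖ e = μᵖ (⟨ sndᵖ ▹ e , fstᵖ ⟩ᵖ ▹ distᵖ)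

inverseᴿ : ∀ {e} {F G : ℕ → ℕ} → Realises nat nat e F →
           (∀ x → G (F x) ≡ x) → (∀ y → F (G y) ≡ y) → Realises nat nat (inverseᵖ e) G
inverseᴿ {F = F} {G} rF G∘F F∘G =
  μᴿ (▹ᴿ {ey = nat ⊗ nat} (pairᴿ (▹ᴿ sndᴿ rF) fstᴿ) distᴿ) G found earlier
  where
  found : ∀ y → ∣ F (G y) - y ∣ ≡ 0
  found y = trans (cong (λ z → ∣ z - y ∣) (F∘G y)) (∣n-n∣≡0 y)
  earlier : ∀ y i → i < G y → ∣ F i - y ∣ ≢ 0
  earlier y i i<Gy dist≡0 = <⇒≢ i<Gy (trans (sym (G∘F i)) (cong G (∣m-n∣≡0⇒m≡n dist≡0)))

-- A program text with a hole for a program index; compile t computes ρ ↦ ⟦ t ⟧ ρ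
-- (an instance of the s-m-n theorem), which makes the decider uniform in f′.
infixr 5 _∙_
data Code : Set where
  param : Code
  lit   : ℕ → Code
  _∙_   : Code → Code → Code

⟦_⟧ : Code → ℕ → ℕ
⟦ param ⟧ ρ = ρ
⟦ lit n ⟧ ρ = n
⟦ a ∙ b ⟧ ρ = ⦅ ⟦ a ⟧ ρ , ⟦ b ⟧ ρ ⦆

compile : Code → ℕ
compile param   = idᵖ
compile (lit n) = constᵖ n
compile (a ∙ b) = ⟨ compile a , compile b ⟩ᵖ

compile-realises : ∀ t → Realises nat nat (compile t) ⟦ t ⟧
compile-realises param   = idᴿ
compile-realises (lit n) = constᴿ n
compile-realises (a ∙ b) = realise (run (pairᴿ (compile-realises a) (compile-realises b)))

infixl 5 _▹ᶜ_
_▹ᶜ_ ⟨_,_⟩ᶜ recᶜ : Code → Code → Code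
a ▹ᶜ b      = lit 5 ∙ a ∙ b
⟨ a , b ⟩ᶜ  = lit 6 ∙ a ∙ b
recᶜ a b    = lit 7 ∙ a ∙ b

data Offset : ℕ → ℕ → Set where
  below : ∀ m d → Offset m (m + d)
  above : ∀ n d → Offset (n + suc d) n

offset : ∀ m n → Offset m n
offset zero    n       = below 0 n
offset (suc m) zero    = above 0 m
offset (suc m) (suc n) with offset m n
... | below m d = below (suc m) d
... | above n d = above (suc n) d

data ParityView : ℕ → Set where
  even : ∀ r → ParityView (r + r)
  odd  : ∀ r → ParityView (suc (r + r))

parityView : ∀ n → ParityView n
parityView zero = even 0
parityView (suc n) with parityView n
... | even r = odd r
... | odd r  = subst ParityView (cong suc (+-suc r r)) (even (suc r))

module _ (g : ℕ → ℕ) where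

  iter-+ : ∀ m n x → iter g (m + n) x ≡ iter g m (iter g n x)
  iter-+ zero    n x = refl
  iter-+ (suc m) n x = cong g (iter-+ m n x)

  iter-sucʳ : ∀ n x → iter g (suc n) x ≡ iter g n (g x)
  iter-sucʳ zero    x = refl
  iter-sucʳ (suc n) x = cong g (iter-sucʳ n x)

  iter-comm : ∀ m n x → iter g m (iter g n x) ≡ iter g n (iter g m x)
  iter-comm m n x = trans (sym (iter-+ m n x)) (trans (cong (λ k → iter g k x) (+-comm m n)) (iter-+ n m x))

  module _ (t : ℕ) .{{_ : NonZero t}} {a : ℕ} (period : iter g t a ≡ a) where

    iter-*-period : ∀ q → iter g (q * t) a ≡ a
    iter-*-period zero    = refl
    iter-*-period (suc q) = trans (iter-+ t (q * t) a) (trans (cong (iter g t) (iter-*-period q)) period)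

    iter-%-period : ∀ n → iter g n a ≡ iter g (n % t) a
    iter-%-period n = begin
      iter g n a                               ≡⟨ cong (λ k → iter g k a) (m≡m%n+[m/n]*n n t) ⟩
      iter g (n % t + (n / t) * t) a           ≡⟨ iter-+ (n % t) ((n / t) * t) a ⟩
      iter g (n % t) (iter g ((n / t) * t) a)  ≡⟨ cong (iter g (n % t)) (iter-*-period (n / t)) ⟩
      iter g (n % t) a                         ∎
      where open ≡-Reasoning

module _ (g k : ℕ → ℕ) (k∘g : ∀ x → k (g x) ≡ x) where

  iter-inverseˡ : ∀ n x → iter k n (iter g n x) ≡ x
  iter-inverseˡ zero    x = refl
  iter-inverseˡ (suc n) x = begin
    iter k (suc n) (g (iter g n x))  ≡⟨ iter-sucʳ k n _ ⟩
    iter k n (k (g (iter g n x)))    ≡⟨ cong (iter k n) (k∘g _) ⟩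
    iter k n (iter g n x)            ≡⟨ iter-inverseˡ n x ⟩
    x                                ∎
    where open ≡-Reasoning

  iter-injective : ∀ n {x y} → iter g n x ≡ iter g n y → x ≡ y
  iter-injective n {x} {y} e = trans (sym (iter-inverseˡ n x)) (trans (cong (iter k n) e) (iter-inverseˡ n y))

  iter-collision : ∀ a r r' → iter g r a ≡ iter g r' a →
    r ≡ r' ⊎ Σ ℕ λ d → 1 ≤ d × iter g d a ≡ a × (d ≤ r ⊎ d ≤ r')
  iter-collision a r r' e with offset r r'
  ... | below r zero    = inj₁ (sym (+-identityʳ r))
  ... | below r (suc d) = inj₂ (suc d , s≤s z≤n ,
          sym (iter-injective r (trans e (iter-+ g r (suc d) a))) , inj₂ (m≤n+m (suc d) r))
  ... | above r' d      = inj₂ (suc d , s≤s z≤n ,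
          sym (iter-injective r' (trans (sym e) (iter-+ g r' (suc d) a))) , inj₁ (m≤n+m (suc d) r'))

Linked : (ℕ → ℕ) → ℕ → ℕ → ℕ → Set
Linked g n x y = iter g n x ≡ y ⊎ iter g n y ≡ x

δinv-even : ∀ r → δinv (r + r) ≡ + r
δinv-odd  : ∀ r → δinv (suc (r + r)) ≡ -[1+ r ]
δinv-even zero    = refl
δinv-even (suc r) rewrite +-suc r r = cong growℤ (δinv-even r)
δinv-odd  zero    = refl
δinv-odd  (suc r) rewrite +-suc r r = cong growℤ (δinv-odd r)

δ : ℤ → ℕ
δ (+ r)    = r + r
δ -[1+ r ] = suc (r + r)

δinv-δ : ∀ k → δinv (δ k) ≡ k
δinv-δ (+ r)    = δinv-even r
δinv-δ -[1+ r ] = δinv-odd r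

module _ {P : ℕ → Set} (P? : ∀ n → Dec (P n)) where

  searchBelow : ∀ n → (Σ ℕ λ m → m < n × P m × (∀ i → i < m → ¬ P i)) ⊎ (∀ i → i < n → ¬ P i)
  searchBelow zero = inj₂ λ _ ()
  searchBelow (suc n) with searchBelow n
  ... | inj₁ (m , m<n , pm , minimal) = inj₁ (m , m<n⇒m<1+n m<n , pm , minimal)
  ... | inj₂ none with P? n
  ...   | yes pn = inj₁ (n , n<1+n n , pn , none)
  ...   | no ¬pn = inj₂ λ i i<1+n → [ none i , (λ { refl → ¬pn }) ]′ (m≤n⇒m<n∨m≡n (s≤s⁻¹ i<1+n))

  least-witness : ∀ {n} → P n → Σ ℕ λ m → P m × (∀ i → i < m → ¬ P i)
  least-witness {n} pn with searchBelow (suc n)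
  ... | inj₁ (m , _ , pm , minimal) = m , pm , minimal
  ... | inj₂ none                  = ⊥-elim (none n (n<1+n n) pn)

module Orbits (p : Perm) where

  F G : ℕ → ℕ
  F = fun p
  G = inv p

  G^n∘F^n : ∀ n x → iter G n (iter F n x) ≡ x
  G^n∘F^n = iter-inverseˡ F G (inv-fun p)

  F^n∘G^n : ∀ n x → iter F n (iter G n x) ≡ x
  F^n∘G^n = iter-inverseˡ G F (fun-inv p)

  F^n-injective : ∀ n {x y} → iter F n x ≡ iter F n y → x ≡ y
  F^n-injective = iter-injective F G (inv-fun p)

  Reach : ℕ → ℕ → Set
  Reach x y = ∃ λ n → Linked F n x y

  Meet : ℕ → ℕ → Set
  Meet x y = ∃ λ m → ∃ λ n → iter F m x ≡ iter F n y

  reach⇒meet : ∀ {x y} → Reach x y → Meet x y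
  reach⇒meet (n , inj₁ e) = n , 0 , e
  reach⇒meet (n , inj₂ e) = 0 , n , sym e

  meet⇒linked : ∀ {x y} m n → iter F m x ≡ iter F n y → Σ ℕ λ k → k ≤ m + n × Linked F k x y
  meet⇒linked {x} {y} m n e with offset m n
  ... | below m d = d , ≤-trans (m≤n+m d m) (m≤n+m (m + d) m) ,
                    inj₂ (F^n-injective m (trans (sym (iter-+ F m d y)) (sym e)))
  ... | above n d = suc d , ≤-trans (m≤n+m (suc d) n) (m≤m+n (n + suc d) n) ,
                    inj₁ (F^n-injective n (trans (sym (iter-+ F n (suc d) x)) e))

  meet⇒reach : ∀ {x y} → Meet x y → Reach x y
  meet⇒reach (m , n , e) with meet⇒linked m n e
  ... | k , _ , link = k , link

  meet-sym : ∀ {x y} → Meet x y → Meet y x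
  meet-sym (m , n , e) = n , m , sym e

  meet-trans : ∀ {x y z} → Meet x y → Meet y z → Meet x z
  meet-trans {x} {y} {z} (m , n , e) (m' , n' , e') = m' + m , n + n' , (begin
    iter F (m' + m) x       ≡⟨ iter-+ F m' m x ⟩
    iter F m' (iter F m x)  ≡⟨ cong (iter F m') e ⟩
    iter F m' (iter F n y)  ≡⟨ iter-comm F m' n y ⟩
    iter F n (iter F m' y)  ≡⟨ cong (iter F n) e' ⟩
    iter F n (iter F n' z)  ≡⟨ sym (iter-+ F n n' z) ⟩
    iter F (n + n') z       ∎)
    where open ≡-Reasoning

  reach-sym : ∀ {x y} → Reach x y → Reach y x
  reach-sym rxy = meet⇒reach (meet-sym (reach⇒meet rxy))

  reach-trans : ∀ {x y z} → Reach x y → Reach y z → Reach x z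
  reach-trans rxy ryz = meet⇒reach (meet-trans (reach⇒meet rxy) (reach⇒meet ryz))

  sameCycle⇒reach : ∀ {x y} → SameCycle p x y → Reach x y
  sameCycle⇒reach (+ n , e)                = n , inj₁ e
  sameCycle⇒reach {x} (-[1+ n ] , refl) = suc n , inj₂ (F^n∘G^n (suc n) x)

  reach⇒sameCycle : ∀ {x y} → Reach x y → SameCycle p x y
  reach⇒sameCycle (n , inj₁ e)          = + n , e
  reach⇒sameCycle (zero , inj₂ e)       = + 0 , sym e
  reach⇒sameCycle {y = y} (suc n , inj₂ refl) = -[1+ n ] , G^n∘F^n (suc n) y

  sameCycle-refl : ∀ x → SameCycle p x x
  sameCycle-refl x = + 0 , refl

  sameCycle-sym : ∀ {x y} → SameCycle p x y → SameCycle p y x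
  sameCycle-sym s = reach⇒sameCycle (reach-sym (sameCycle⇒reach s))

  sameCycle-trans : ∀ {x y z} → SameCycle p x y → SameCycle p y z → SameCycle p x z
  sameCycle-trans s s' = reach⇒sameCycle (reach-trans (sameCycle⇒reach s) (sameCycle⇒reach s'))

  -- enum a lists the cycle of a as a, f⁻¹ a, f a, f⁻² a, f² a, …, as j ↦ f^{δ⁻¹ j}(a) in the paper.
  enum : ℕ → ℕ → ℕ
  enum a i = pow p (δinv i) a

  enum-even : ∀ a r → enum a (r + r) ≡ iter F r a
  enum-even a r = cong (λ k → pow p k a) (δinv-even r)

  enum-odd : ∀ a r → enum a (suc (r + r)) ≡ iter G (suc r) a
  enum-odd a r = cong (λ k → pow p k a) (δinv-odd r)

  sameCycle-enum : ∀ a i → SameCycle p a (enum a i)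
  sameCycle-enum a i = δinv i , refl

  CycleLengthGreater-≤ : ∀ {a m m'} → m' ≤ m → CycleLengthGreater p a m → CycleLengthGreater p a m'
  CycleLengthGreater-≤ m'≤m long i 1≤i i≤m' = long i 1≤i (≤-trans i≤m' m'≤m)

  cycleLengthGreater-or-period : ∀ a m →
    CycleLengthGreater p a m ⊎ Σ ℕ λ t → 1 ≤ t × t ≤ m × iter F t a ≡ a
  cycleLengthGreater-or-period a m with searchBelow (λ t → (1 ≤? t) ×-dec (iter F t a ≟ a)) (suc m)
  ... | inj₁ (t , t<1+m , (1≤t , period) , _) = inj₂ (t , 1≤t , s≤s⁻¹ t<1+m , period)
  ... | inj₂ none = inj₁ λ i 1≤i i≤m period → none i (s≤s i≤m) (1≤i , period)

  module _ {a t : ℕ} .{{_ : NonZero t}} (period : iter F t a ≡ a) where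

    reach⇒forward : ∀ {x} → Reach a x → Σ ℕ λ r → r < t × iter F r a ≡ x
    reach⇒forward (n , inj₁ e) = n % t , m%n<n n t , trans (sym (iter-%-period F t period n)) e
    reach⇒forward {x} (n , inj₂ e) =
      (t ∸ r) % t , m%n<n (t ∸ r) t , trans (sym (iter-%-period F t period (t ∸ r))) back
      where
      x-period : iter F t x ≡ x
      x-period = F^n-injective n (trans (iter-comm F n t x) (trans (cong (iter F t) e) (trans period (sym e))))
      r = n % t
      a≡F^r[x] : a ≡ iter F r x
      a≡F^r[x] = trans (sym e) (iter-%-period F t x-period n)
      back : iter F (t ∸ r) a ≡ x
      back = begin
        iter F (t ∸ r) a                ≡⟨ cong (iter F (t ∸ r)) a≡F^r[x] ⟩
        iter F (t ∸ r) (iter F r x)     ≡⟨ sym (iter-+ F (t ∸ r) r x) ⟩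
        iter F (t ∸ r + r) x            ≡⟨ cong (λ k → iter F k x) (m∸n+n≡m (<⇒≤ (m%n<n n t))) ⟩
        iter F t x                      ≡⟨ x-period ⟩
        x                               ∎
        where open ≡-Reasoning

    -- f^r a is enum a (2r) when 2r < t; otherwise, writing t = r + s + 1, it is f^{-(s+1)} a,
    -- which is enum a (2s + 1).
    enum-covers-iter : ∀ r → r < t → Σ ℕ λ i → i < t × enum a i ≡ iter F r a
    enum-covers-iter r r<t with r + r <? t | offset r t
    ... | yes r+r<t | _ = r + r , r+r<t , enum-even a r
    ... | no _ | above t d = ⊥-elim (<⇒≱ r<t (m≤m+n t (suc d)))
    ... | no _ | below r zero = ⊥-elim (<-irrefl (sym (+-identityʳ r)) r<t)
    ... | no r+r≮t | below r (suc s) = suc (s + s) , i<t , back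
      where
      1+s≤r : suc s ≤ r
      1+s≤r = +-cancelˡ-≤ r (suc s) r (≮⇒≥ r+r≮t)
      i<t : suc (s + s) < r + suc s
      i<t = subst (_< r + suc s) (+-suc s s) (+-monoˡ-< (suc s) 1+s≤r)
      back : enum a (suc (s + s)) ≡ iter F r a
      back = begin
        enum a (suc (s + s))                             ≡⟨ enum-odd a s ⟩
        iter G (suc s) a                                 ≡⟨ cong (iter G (suc s)) (sym period) ⟩
        iter G (suc s) (iter F (r + suc s) a)            ≡⟨ cong (λ k → iter G (suc s) (iter F k a)) (+-comm r (suc s)) ⟩
        iter G (suc s) (iter F (suc s + r) a)            ≡⟨ cong (iter G (suc s)) (iter-+ F (suc s) r a) ⟩
        iter G (suc s) (iter F (suc s) (iter F r a))     ≡⟨ G^n∘F^n (suc s) (iter F r a) ⟩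
        iter F r a                                       ∎
        where open ≡-Reasoning

    enum-covers : ∀ {x} → Reach a x → Σ ℕ λ i → i < t × enum a i ≡ x
    enum-covers rx with reach⇒forward rx
    ... | r , r<t , refl = enum-covers-iter r r<t

  module _ {a m : ℕ} (long : CycleLengthGreater p a m) where

    private
      no-collision : ∀ (g k : ℕ → ℕ) → (∀ x → k (g x) ≡ x) →
                     (∀ d → iter g d a ≡ a → iter F d a ≡ a) →
                     ∀ r r' → r ≤ m → r' ≤ m → iter g r a ≡ iter g r' a → r ≡ r'
      no-collision g k k∘g toF r r' r≤m r'≤m e with iter-collision g k k∘g a r r' e
      ... | inj₁ r≡r'                        = r≡r'
      ... | inj₂ (d , 1≤d , period , inj₁ d≤r)  = ⊥-elim (long d 1≤d (≤-trans d≤r r≤m) (toF d period))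
      ... | inj₂ (d , 1≤d , period , inj₂ d≤r') = ⊥-elim (long d 1≤d (≤-trans d≤r' r'≤m) (toF d period))

      G-period⇒F-period : ∀ d → iter G d a ≡ a → iter F d a ≡ a
      G-period⇒F-period d period = trans (cong (iter F d) (sym period)) (F^n∘G^n d a)

      no-mixed-collision : ∀ r s → r + r ≤ m → suc (s + s) ≤ m → iter F r a ≢ iter G (suc s) a
      no-mixed-collision r s r+r≤m 1+s+s≤m e = long (suc s + r) (s≤s z≤n) bound (begin
        iter F (suc s + r) a               ≡⟨ iter-+ F (suc s) r a ⟩
        iter F (suc s) (iter F r a)        ≡⟨ cong (iter F (suc s)) e ⟩
        iter F (suc s) (iter G (suc s) a)  ≡⟨ F^n∘G^n (suc s) a ⟩
        a                                  ∎)
        where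
        open ≡-Reasoning
        bound : suc s + r ≤ m
        bound with r ≤? s
        ... | yes r≤s = ≤-trans (s≤s (+-monoʳ-≤ s r≤s)) 1+s+s≤m
        ... | no r≰s  = ≤-trans (+-monoˡ-≤ r (≰⇒> r≰s)) r+r≤m

      double-≤ : ∀ r → r + r ≤ m → r ≤ m
      double-≤ r r+r≤m = ≤-trans (m≤m+n r r) r+r≤m

      odd-≤ : ∀ s → suc (s + s) ≤ m → suc s ≤ m
      odd-≤ s 1+s+s≤m = ≤-trans (s≤s (m≤m+n s s)) 1+s+s≤m

    enum-injective-≤ : ∀ {i i'} → i ≤ m → i' ≤ m → enum a i ≡ enum a i' → i ≡ i'
    enum-injective-≤ {i} {i'} i≤m i'≤m e with parityView i | parityView i'
    ... | even r | even r' = cong (λ k → k + k)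
      (no-collision F G (inv-fun p) (λ _ period → period) r r' (double-≤ r i≤m) (double-≤ r' i'≤m)
        (trans (sym (enum-even a r)) (trans e (enum-even a r'))))
    ... | odd s | odd s' = cong (λ k → suc (k + k)) (suc-injective
      (no-collision G F (fun-inv p) G-period⇒F-period (suc s) (suc s') (odd-≤ s i≤m) (odd-≤ s' i'≤m)
        (trans (sym (enum-odd a s)) (trans e (enum-odd a s')))))
    ... | even r | odd s = ⊥-elim (no-mixed-collision r s i≤m i'≤m
      (trans (sym (enum-even a r)) (trans e (enum-odd a s))))
    ... | odd s | even r = ⊥-elim (no-mixed-collision r s i'≤m i≤m
      (trans (sym (enum-even a r)) (trans (sym e) (enum-odd a s))))

  enum-injective : ∀ {a i i'} → CycleLengthGreater p a i → CycleLengthGreater p a i' →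
                   enum a i ≡ enum a i' → i ≡ i'
  enum-injective {i = i} {i'} long long' e with ≤-total i i'
  ... | inj₁ i≤i' = enum-injective-≤ long' i≤i' ≤-refl e
  ... | inj₂ i'≤i = enum-injective-≤ long ≤-refl i'≤i e

  enum-index : ∀ {a x} → SameCycle p a x → Σ ℕ λ j → enum a j ≡ x × CycleLengthGreater p a j
  enum-index {a} {x} (k , e)
    with least-witness (λ i → enum a i ≟ x) {δ k} (trans (cong (λ k → pow p k a) (δinv-δ k)) e)
  ... | j , ej , minimal = j , ej , long
    where
    long : CycleLengthGreater p a j
    long zero () _ _
    long (suc t) _ t≤j period with enum-covers period (sameCycle⇒reach (k , e))
    ... | i , i<t , ei = minimal i (≤-trans i<t t≤j) ei

conjugate : Perm → Perm → Perm
conjugate h f = record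
  { fun     = λ x → fun h (fun f (inv h x))
  ; inv     = λ x → fun h (inv f (inv h x))
  ; inv-fun = λ x → trans (cong (λ v → fun h (inv f v)) (inv-fun h _)) (trans (cong (fun h) (inv-fun f _)) (fun-inv h x))
  ; fun-inv = λ x → trans (cong (λ v → fun h (fun f v)) (inv-fun h _)) (trans (cong (fun h) (fun-inv f _)) (fun-inv h x))
  }

module _ (h f : Perm) where

  private
    iter-conjugate : ∀ (K : ℕ → ℕ) n x → iter (λ y → fun h (K (inv h y))) n x ≡ fun h (iter K n (inv h x))
    iter-conjugate K zero    x = sym (fun-inv h x)
    iter-conjugate K (suc n) x = cong (λ v → fun h (K v)) (trans (cong (inv h) (iter-conjugate K n x)) (inv-fun h _))

  pow-conjugate : ∀ k x → pow (conjugate h f) k x ≡ fun h (pow f k (inv h x))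
  pow-conjugate (+ n)    = iter-conjugate (fun f) n
  pow-conjugate -[1+ n ] = iter-conjugate (inv f) (suc n)

  conjugate-unconjugate : ∀ x → fun f x ≡ inv h (fun (conjugate h f) (fun h x))
  conjugate-unconjugate x = sym (trans (inv-fun h _) (cong (fun f) (inv-fun h x)))

  conjugate-cycleLength : ∀ {a m} → inv h a ≡ a →
    CycleLengthGreater (conjugate h f) a m → CycleLengthGreater f a m
  conjugate-cycleLength {a} fixed long i 1≤i i≤m period = long i 1≤i i≤m (begin
    iter (fun (conjugate h f)) i a  ≡⟨ pow-conjugate (+ i) a ⟩
    fun h (iter (fun f) i (inv h a))  ≡⟨ cong (λ v → fun h (iter (fun f) i v)) fixed ⟩
    fun h (iter (fun f) i a)          ≡⟨ cong (fun h) period ⟩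
    fun h a                           ≡⟨ cong (fun h) (sym fixed) ⟩
    fun h (inv h a)                   ≡⟨ fun-inv h a ⟩
    a                                 ∎)
    where open ≡-Reasoning

  conjugate-samePart : (∀ x → SameCycle f x (inv h x)) → SamePart (conjugate h f) f
  conjugate-samePart stays x x' = mk⇔ to from
    where
    open Orbits f
    to : SameCycle (conjugate h f) x x' → SameCycle f x x'
    to (k , e) = sameCycle-trans (stays x) (sameCycle-trans (k , e') (sameCycle-sym (stays x')))
      where
      e' : pow f k (inv h x) ≡ inv h x'
      e' = trans (sym (inv-fun h _)) (cong (inv h) (trans (sym (pow-conjugate k x)) e))
    from : SameCycle f x x' → SameCycle (conjugate h f) x x'
    from x~x' with sameCycle-trans (sameCycle-sym (stays x)) (sameCycle-trans x~x' (stays x'))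
    ... | k , e = k , trans (pow-conjugate k x) (trans (cong (fun h) e) (fun-inv h x'))

enumᵖ : ℕ → ℕ → ℕ
enumᵖ e e⁻¹ =
  ⟨ ⟨ forward , backward ⟩ᵖ , sndᵖ ▹ halvesᵖ ▹ ⟨ sndᵖ , fstᵖ ⟩ᵖ ▹ monusᵖ ⟩ᵖ ▹ ifZeroᵖ
  where
  forward backward : ℕ
  forward  = ⟨ fstᵖ , sndᵖ ▹ halvesᵖ ▹ fstᵖ ⟩ᵖ ▹ iterᵖ e
  backward = ⟨ fstᵖ , sndᵖ ▹ halvesᵖ ▹ sndᵖ ⟩ᵖ ▹ iterᵖ e⁻¹

module _ (p : Perm) where
  open Orbits p

  enum-halves : ∀ a i → enum a i ≡ ifZero (⌈ i /2⌉ ∸ ⌊ i /2⌋) (iter F ⌊ i /2⌋ a) (iter G ⌈ i /2⌉ a)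
  enum-halves a i with parityView i
  ... | even r rewrite sym (n≡⌊n+n/2⌋ r) | sym (n≡⌈n+n/2⌉ r) | n∸n≡0 r = enum-even a r
  ... | odd r  rewrite sym (n≡⌈n+n/2⌉ r) | sym (n≡⌊n+n/2⌋ r) | m+n∸n≡m 1 r = enum-odd a r

  enumᴿ : ∀ {e e⁻¹} → Realises nat nat e F → Realises nat nat e⁻¹ G →
          Realises (nat ⊗ nat) nat (enumᵖ e e⁻¹) (λ (a , i) → enum a i)
  enumᴿ rF rG = Realises-cong (λ (a , i) → sym (enum-halves a i))
    (▹ᴿ {ey = (nat ⊗ nat) ⊗ nat}
        (pairᴿ (pairᴿ (iterate rF fstᴿ) (iterate rG sndᴿ))
               (▹ᴿ {ey = nat ⊗ nat} (▹ᴿ (▹ᴿ sndᴿ halvesᴿ) (pairᴿ sndᴿ fstᴿ)) monusᴿ))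
        ifZeroᴿ)
    where
    iterate : ∀ {e s} {K : ℕ → ℕ} {S : ℕ × ℕ → ℕ} →
              Realises nat nat e K → Realises (nat ⊗ nat) nat s S →
              Realises (nat ⊗ nat) nat (⟨ fstᵖ , sndᵖ ▹ halvesᵖ ▹ s ⟩ᵖ ▹ iterᵖ e)
                       (λ (a , i) → iter K (S (⌊ i /2⌋ , ⌈ i /2⌉)) a)
    iterate rK rS = ▹ᴿ {ey = nat ⊗ nat} (pairᴿ fstᴿ (▹ᴿ (▹ᴿ sndᴿ halvesᴿ) rS)) (iterᴿ rK)

module NormalCycles (p : Perm) (normal : IsNormal p) where
  open Orbits p

  -- The least element of a cycle cannot be found effectively, but only a refutation
  -- is drawn from it below, so its double-negated existence suffices.
  ¬¬least-in-cycle : ∀ x → ¬ ¬ (Σ ℕ λ a → SameCycle p a x × LeastInCycle p a)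
  ¬¬least-in-cycle x none = notInCycle x (sameCycle-refl x)
    where
    notInCycle : ∀ n → ¬ SameCycle p x n
    notInCycle = <-rec _ λ n below x~n →
      none (n , sameCycle-sym x~n , λ y n~y → ≮⇒≥ λ y<n → below y<n (sameCycle-trans x~n n~y))

  index≤enum : ∀ {a m} → LeastInCycle p a → CycleLengthGreater p a m → ∀ i → i ≤ m → i ≤ enum a i
  index≤enum least long zero    _     = z≤n
  index≤enum least long (suc i) 1+i≤m =
    ≤-trans (s≤s (index≤enum least long i (<⇒≤ 1+i≤m))) (normal _ least i (CycleLengthGreater-≤ 1+i≤m long))

  private
    F^r-meets-G^s : ∀ a r s → iter F r a ≡ iter F (r + suc s) (iter G (suc s) a)
    F^r-meets-G^s a r s = sym (trans (iter-+ F r (suc s) _) (cong (iter F r) (F^n∘G^n (suc s) a)))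

    ≤-double : ∀ r → r ≤ r + r
    ≤-double r = m≤m+n r r

    even-odd-bound : ∀ r s → r + suc s ≤ (r + r) + suc (s + s)
    even-odd-bound r s = +-mono-≤ (≤-double r) (s≤s (≤-double s))

  enum-meet : ∀ a j j' → Σ ℕ λ m → Σ ℕ λ n → m + n ≤ j + j' × iter F m (enum a j) ≡ iter F n (enum a j')
  enum-meet a j j' with parityView j | parityView j'
  ... | even r | even r' rewrite enum-even a r | enum-even a r' =
    r' , r , subst (_≤ (r + r) + (r' + r')) (+-comm r r') (+-mono-≤ (≤-double r) (≤-double r')) ,
    iter-comm F r' r a
  ... | even r | odd s' rewrite enum-even a r | enum-odd a s' =
    0 , r + suc s' , even-odd-bound r s' , F^r-meets-G^s a r s'
  ... | odd s | even r' rewrite enum-odd a s | enum-even a r' =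
    r' + suc s , 0 , subst₂ _≤_ (sym (+-identityʳ _)) (+-comm (r' + r') _) (even-odd-bound r' s) ,
    sym (F^r-meets-G^s a r' s)
  ... | odd s | odd s' rewrite enum-odd a s | enum-odd a s' =
    suc s , suc s' , +-mono-≤ (s≤s (≤-double s)) (s≤s (≤-double s')) ,
    trans (F^n∘G^n (suc s) a) (sym (F^n∘G^n (suc s') a))

  -- In normal form the i-th enumerated element is at least i, so two elements x, x' of a
  -- cycle are at most x + x' steps apart.
  linked-within : ∀ {x x'} → SameCycle p x x' → ¬ ¬ (Σ ℕ λ k → k ≤ x + x' × Linked F k x x')
  linked-within {x} {x'} x~x' none = ¬¬least-in-cycle x λ (a , a~x , least) → go a~x least
    where
    go : ∀ {a} → SameCycle p a x → LeastInCycle p a → ⊥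
    go {a} a~x least with enum-index a~x | enum-index (sameCycle-trans a~x x~x')
    ... | j , refl , long | j' , refl , long' with enum-meet a j j'
    ... | m , n , m+n≤ , e with meet⇒linked m n e
    ... | k , k≤m+n , link =
      none (k , ≤-trans k≤m+n (≤-trans m+n≤ (+-mono-≤ (index≤enum least long j ≤-refl)
                                                      (index≤enum least long' j' ≤-refl))) ,
            link)

χ≡ : ℕ → ℕ → ℕ
χ≡ a b = 1 ∸ ∣ a - b ∣

χ≡-refl : ∀ a → χ≡ a a ≡ 1
χ≡-refl a = cong (1 ∸_) (∣n-n∣≡0 a)

χ≡-≢ : ∀ {a b} → a ≢ b → χ≡ a b ≡ 0
χ≡-≢ {a} {b} a≢b with ∣ a - b ∣ in eq
... | zero  = ⊥-elim (a≢b (∣m-n∣≡0⇒m≡n eq))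
... | suc n = 0∸n≡0 n

module LinkSearch (F : ℕ → ℕ) where

  linkTest : ℕ → ℕ → ℕ → ℕ
  linkTest x x' k = χ≡ (iter F k x) x' + χ≡ (iter F k x') x

  linkCount : ℕ → ℕ → ℕ → ℕ
  linkCount x x' zero    = linkTest x x' 0
  linkCount x x' (suc n) = linkTest x x' (suc n) + linkCount x x' n

  linkTest-pos : ∀ x x' k → linkTest x x' k ≢ 0 → Linked F k x x'
  linkTest-pos x x' k test≢0 with iter F k x ≟ x' | iter F k x' ≟ x
  ... | yes e | _     = inj₁ e
  ... | no _  | yes e = inj₂ e
  ... | no ne | no ne' = ⊥-elim (test≢0 (cong₂ _+_ (χ≡-≢ ne) (χ≡-≢ ne')))

  linkTest-zero : ∀ x x' k → linkTest x x' k ≡ 0 → ¬ Linked F k x x'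
  linkTest-zero x x' k test≡0 (inj₁ refl) = 0≢1+n (trans (sym (m+n≡0⇒m≡0 _ test≡0)) (χ≡-refl x'))
  linkTest-zero x x' k test≡0 (inj₂ refl) = 0≢1+n (trans (sym (m+n≡0⇒n≡0 _ test≡0)) (χ≡-refl x))

  linkCount-pos : ∀ x x' n → linkCount x x' n ≢ 0 → Σ ℕ λ k → Linked F k x x'
  linkCount-pos x x' zero count≢0 = 0 , linkTest-pos x x' 0 count≢0
  linkCount-pos x x' (suc n) count≢0 with linkTest x x' (suc n) ≟ 0
  ... | no test≢0  = suc n , linkTest-pos x x' (suc n) test≢0
  ... | yes test≡0 = linkCount-pos x x' n λ rest≡0 → count≢0 (cong₂ _+_ test≡0 rest≡0)

  linkCount-zero : ∀ x x' n → linkCount x x' n ≡ 0 → ∀ k → k ≤ n → ¬ Linked F k x x'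
  linkCount-zero x x' zero    count≡0 zero    _   = linkTest-zero x x' 0 count≡0
  linkCount-zero x x' (suc n) count≡0 k       k≤n with m≤n⇒m<n∨m≡n k≤n
  ... | inj₂ refl = linkTest-zero x x' (suc n) (m+n≡0⇒m≡0 _ count≡0)
  ... | inj₁ k<1+n = linkCount-zero x x' n (m+n≡0⇒n≡0 _ count≡0) k (s≤s⁻¹ k<1+n)

linkTestᶜ linkCountᶜ deciderᶜ : Code
linkTestᶜ = ⟨ ⟨ iterate (fstᵖ ▹ fstᵖ) , lit (fstᵖ ▹ sndᵖ) ⟩ᶜ ▹ᶜ lit eqᵖ
            , ⟨ iterate (fstᵖ ▹ sndᵖ) , lit (fstᵖ ▹ fstᵖ) ⟩ᶜ ▹ᶜ lit eqᵖ ⟩ᶜ ▹ᶜ lit addᵖ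
  where
  iterate : ℕ → Code
  iterate start = ⟨ lit start , lit sndᵖ ⟩ᶜ ▹ᶜ recᶜ (lit idᵖ) (lit (sndᵖ ▹ sndᵖ) ▹ᶜ param)
linkCountᶜ = recᶜ (lit ⟨ idᵖ , zeroᵖ ⟩ᵖ ▹ᶜ linkTestᶜ)
                  (⟨ lit ⟨ fstᵖ , sndᵖ ▹ fstᵖ ▹ succᵖ ⟩ᵖ ▹ᶜ linkTestᶜ , lit (sndᵖ ▹ sndᵖ) ⟩ᶜ
                   ▹ᶜ lit addᵖ)
deciderᶜ   = lit ⟨ idᵖ , addᵖ ⟩ᵖ ▹ᶜ linkCountᶜ ▹ᶜ lit signᵖ

module _ {e : ℕ} {F : ℕ → ℕ} (rF : Realises nat nat e F) where
  open LinkSearch F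

  private
    Triple : Set
    Triple = (ℕ × ℕ) × ℕ

    triple : Triple → ℕ
    triple = (nat ⊗ nat) ⊗ nat

  linkTestᴿ : Realises triple nat (⟦ linkTestᶜ ⟧ e) (λ ((x , x') , k) → linkTest x x' k)
  linkTestᴿ = ▹ᴿ {ey = nat ⊗ nat} (pairᴿ (match first second) (match second first)) addᴿ
    where
    first : Realises triple nat (fstᵖ ▹ fstᵖ) (λ ((x , _) , _) → x)
    first = ▹ᴿ {ey = nat ⊗ nat} fstᴿ fstᴿ
    second : Realises triple nat (fstᵖ ▹ sndᵖ) (λ ((_ , x') , _) → x')
    second = ▹ᴿ {ey = nat ⊗ nat} fstᴿ sndᴿ
    match : ∀ {s t} {S T : Triple → ℕ} → Realises triple nat s S → Realises triple nat t T →
            Realises triple nat (⟨ ⟨ s , sndᵖ ⟩ᵖ ▹ iterᵖ e , t ⟩ᵖ ▹ eqᵖ) (λ q → χ≡ (iter F (proj₂ q) (S q)) (T q))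
    match rs rt = ▹ᴿ {ey = nat ⊗ nat} (pairᴿ (▹ᴿ {ey = nat ⊗ nat} (pairᴿ rs sndᴿ) (iterᴿ rF)) rt) eqᴿ

  linkCountᴿ : Realises triple nat (⟦ linkCountᶜ ⟧ e) (λ ((x , x') , n) → linkCount x x' n)
  linkCountᴿ = Realises-cong (λ ((x , x') , n) → primRec-linkCount x x' n)
    (recᴿ (▹ᴿ {ey = triple} (pairᴿ idᴿ zeroᴿ) linkTestᴿ)
          (▹ᴿ {ey = nat ⊗ nat} (pairᴿ (▹ᴿ {ey = triple} (pairᴿ fstᴿ next) linkTestᴿ) thirdᴿ) addᴿ))
    where
    next : Realises ((nat ⊗ nat) ⊗ nat ⊗ nat) nat (sndᵖ ▹ fstᵖ ▹ succᵖ) (λ (_ , n , _) → suc n)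
    next = ▹ᴿ (▹ᴿ {ey = nat ⊗ nat} sndᴿ fstᴿ) succᴿ
    primRec-linkCount : ∀ x x' n →
      primRec (λ (x , x') → linkTest x x' 0) (λ ((x , x') , n , r) → linkTest x x' (suc n) + r) ((x , x') , n)
        ≡ linkCount x x' n
    primRec-linkCount x x' zero    = refl
    primRec-linkCount x x' (suc n) = cong (λ r → linkTest x x' (suc n) + r) (primRec-linkCount x x' n)

  deciderᴿ : Realises (nat ⊗ nat) nat (⟦ deciderᶜ ⟧ e) (λ (x , x') → 1 ∸ (1 ∸ linkCount x x' (x + x')))
  deciderᴿ = ▹ᴿ (▹ᴿ {ey = triple} (pairᴿ idᴿ addᴿ) linkCountᴿ) signᴿ

module _ (f f' : Perm) (normal : IsNormal f') (samePart : SamePart f' f) where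
  open LinkSearch (fun f')
  open Orbits f'
  open NormalCycles f' normal

  normal-form-decides : ∀ e → Computes e (fun f') → DecidesPart f (⟦ deciderᶜ ⟧ e)
  normal-form-decides e ce x x' = answer (linkCount x x' (x + x')) refl
    where
    Output : ℕ → Set
    Output = Eval (⟦ deciderᶜ ⟧ e) ⟪ x , x' ⟫

    output : Output (1 ∸ (1 ∸ linkCount x x' (x + x')))
    output = subst (λ u → Eval (⟦ deciderᶜ ⟧ e) u (1 ∸ (1 ∸ linkCount x x' (x + x'))))
                   (⦅,⦆≡⟪,⟫ x x') (run (deciderᴿ (realise ce)) (x , x'))

    reach⇒same : Reach x x' → SameCycle f x x'
    reach⇒same link = Equivalence.to (samePart x x') (reach⇒sameCycle link)

    unlinked⇒different : (∀ k → k ≤ x + x' → ¬ Linked (fun f') k x x') → ¬ SameCycle f x x'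
    unlinked⇒different unlinked x~x' =
      linked-within (Equivalence.from (samePart x x') x~x') λ (k , k≤ , link) → unlinked k k≤ link

    answer : ∀ c → linkCount x x' (x + x') ≡ c → (Output 1 × SameCycle f x x') ⊎ (Output 0 × ¬ SameCycle f x x')
    answer zero count≡0 =
      inj₂ (subst Output (cong (λ c → 1 ∸ (1 ∸ c)) count≡0) output ,
            unlinked⇒different (linkCount-zero x x' (x + x') count≡0))
    answer (suc n) count≡ =
      inj₁ (subst Output (trans (cong (λ c → 1 ∸ (1 ∸ c)) count≡) (cong (1 ∸_) (0∸n≡0 n))) output ,
            reach⇒same (linkCount-pos x x' (x + x') λ count≡0 → 1+n≢0 (trans (sym count≡) count≡0)))

Unique-⊆⇒length≤ : ∀ {xs ys : List ℕ} → Unique xs → xs ⊆ ys → length xs ≤ length ys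
Unique-⊆⇒length≤ {[]}     _              _  = z≤n
Unique-⊆⇒length≤ {x ∷ xs} {ys} (x∉xs ∷ u) xs⊆ys with ∈-∃++ (xs⊆ys (here refl))
... | as , bs , refl = ≤-trans (s≤s (Unique-⊆⇒length≤ u xs⊆as++bs)) (≤-reflexive (sym length-as++x∷bs))
  where
  xs⊆as++bs : xs ⊆ as ++ bs
  xs⊆as++bs {z} z∈xs with ∈-++⁻ as (xs⊆ys (there z∈xs))
  ... | inj₁ z∈as         = ∈-++⁺ˡ z∈as
  ... | inj₂ (here z≡x)   = ⊥-elim (All.lookup x∉xs z∈xs (sym z≡x))
  ... | inj₂ (there z∈bs) = ∈-++⁺ʳ as z∈bs
  length-as++x∷bs : length (as ++ x ∷ bs) ≡ suc (length (as ++ bs))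
  length-as++x∷bs = trans (length-++ as) (trans (+-suc (length as) (length bs)) (cong suc (sym (length-++ as))))

∈⇒≤sum : ∀ {z xs} → z ∈ xs → z ≤ sum xs
∈⇒≤sum {xs = x ∷ xs} (here refl)  = m≤m+n x (sum xs)
∈⇒≤sum {xs = x ∷ xs} (there z∈xs) = ≤-trans (∈⇒≤sum z∈xs) (m≤n+m (sum xs) x)

module Normalisation (f : Perm) (d : ℕ) (decides : DecidesPart f d) where
  open Orbits f

  χ : ℕ → ℕ → ℕ
  χ x y with decides x y
  ... | inj₁ _ = 1
  ... | inj₂ _ = 0

  χ-eval : ∀ x y → Eval d ⦅ x , y ⦆ (χ x y)
  χ-eval x y with decides x y
  ... | inj₁ (run , _) = subst (λ u → Eval d u 1) (sym (⦅,⦆≡⟪,⟫ x y)) run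
  ... | inj₂ (run , _) = subst (λ u → Eval d u 0) (sym (⦅,⦆≡⟪,⟫ x y)) run

  sameCycle? : ∀ x y → Dec (SameCycle f x y)
  sameCycle? x y with decides x y
  ... | inj₁ (_ , x~y) = yes x~y
  ... | inj₂ (_ , x≁y) = no x≁y

  χ-same : ∀ {x y} → SameCycle f x y → χ x y ≡ 1
  χ-same {x} {y} x~y with decides x y
  ... | inj₁ _         = refl
  ... | inj₂ (_ , x≁y) = ⊥-elim (x≁y x~y)

  χ-other : ∀ {x y} → ¬ SameCycle f x y → χ x y ≡ 0
  χ-other {x} {y} x≁y with decides x y
  ... | inj₁ (_ , x~y) = ⊥-elim (x≁y x~y)
  ... | inj₂ _         = refl

  private
    leastInCycleOf : ∀ x → Σ ℕ λ m → SameCycle f x m × (∀ i → i < m → ¬ SameCycle f x i)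
    leastInCycleOf x = least-witness (sameCycle? x) (sameCycle-refl x)

  opaque
    root : ℕ → ℕ
    root x = proj₁ (leastInCycleOf x)

    root-sameCycle : ∀ x → SameCycle f x (root x)
    root-sameCycle x = proj₁ (proj₂ (leastInCycleOf x))

    root-≤ : ∀ {x y} → SameCycle f x y → root x ≤ y
    root-≤ {x} {y} x~y = ≮⇒≥ λ y<root → proj₂ (proj₂ (leastInCycleOf x)) y y<root x~y

  root-cong : ∀ {x y} → SameCycle f x y → root x ≡ root y
  root-cong {x} {y} x~y = ≤-antisym (root-≤ (sameCycle-trans x~y (root-sameCycle y)))
                                    (root-≤ (sameCycle-trans (sameCycle-sym x~y) (root-sameCycle x)))

  root-least : ∀ {a} → LeastInCycle f a → root a ≡ a
  root-least {a} least = ≤-antisym (root-≤ (sameCycle-refl a)) (least _ (root-sameCycle a))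

  count : ℕ → ℕ → ℕ
  count a zero    = 0
  count a (suc n) = χ a n + count a n

  count-mono : ∀ a {m n} → m ≤ n → count a m ≤ count a n
  count-mono a {n = zero}  z≤n   = ≤-refl
  count-mono a {n = suc n} m≤1+n with m≤n⇒m<n∨m≡n m≤1+n
  ... | inj₂ refl  = ≤-refl
  ... | inj₁ m<1+n = ≤-trans (count-mono a (s≤s⁻¹ m<1+n)) (m≤n+m (count a n) (χ a n))

  count-strict : ∀ {a y y'} → SameCycle f a y → y < y' → count a y < count a y'
  count-strict {a} {y} a~y y<y' = subst (λ v → v + count a y ≤ _) (χ-same a~y) (count-mono a y<y')

  count-least : ∀ {a} → LeastInCycle f a → count a a ≡ 0
  count-least {a} least = go a ≤-refl
    where
    go : ∀ n → n ≤ a → count a n ≡ 0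
    go zero    _     = refl
    go (suc n) 1+n≤a = cong₂ _+_ (χ-other λ a~n → <⇒≱ 1+n≤a (least n a~n)) (go n (<⇒≤ 1+n≤a))

  count-intermediate : ∀ a N J → J < count a N → Σ ℕ λ y → SameCycle f a y × count a y ≡ J
  count-intermediate a zero    J ()
  count-intermediate a (suc n) J J<count with J <? count a n | sameCycle? a n
  ... | yes J<     | _       = count-intermediate a n J J<
  ... | no J≮      | yes a~n =
    n , a~n , ≤-antisym (≮⇒≥ J≮) (s≤s⁻¹ (subst (λ v → J < v + count a n) (χ-same a~n) J<count))
  ... | no J≮      | no a≁n  = ⊥-elim (J≮ (subst (λ v → J < v + count a n) (χ-other a≁n) J<count))

  members : ℕ → ℕ → List ℕ
  members a n = filter (sameCycle? a) (downFrom n)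

  length-members : ∀ a n → length (members a n) ≡ count a n
  length-members a zero = refl
  length-members a (suc n) with decides a n
  ... | inj₁ _ = cong suc (length-members a n)
  ... | inj₂ _ = length-members a n

  ∈-members⁻ : ∀ {a n z} → z ∈ members a n → z < n × SameCycle f a z
  ∈-members⁻ {a} {n} z∈ with ∈-filter⁻ (sameCycle? a) {xs = downFrom n} z∈
  ... | z∈downFrom , a~z = ∈-downFrom⁻ z∈downFrom , a~z

  unique-members : ∀ a n → Unique (members a n)
  unique-members a n = Unique.filter⁺ (sameCycle? a) (Unique.downFrom⁺ n)

  count-≥ : ∀ {a N l} → Unique l → (∀ {z} → z ∈ l → z < N × SameCycle f a z) → length l ≤ count a N
  count-≥ {a} {N} {l} unique l⊆ = ≤-trans (Unique-⊆⇒length≤ unique l⊆members) (≤-reflexive (length-members a N))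
    where
    l⊆members : ∀ {z} → z ∈ l → z ∈ members a N
    l⊆members z∈l = ∈-filter⁺ (sameCycle? a) (∈-downFrom⁺ (proj₁ (l⊆ z∈l))) (proj₂ (l⊆ z∈l))

  count-< : ∀ {a y S} → SameCycle f a y → (∀ {z} → SameCycle f a z → z ∈ S) → count a y < length S
  count-< {a} {y} {S} a~y covers =
    ≤-trans (s≤s (≤-reflexive (sym (length-members a y)))) (Unique-⊆⇒length≤ unique y∷members⊆S)
    where
    unique : Unique (y ∷ members a y)
    unique = All.tabulate (λ z∈ y≡z → <-irrefl (sym y≡z) (proj₁ (∈-members⁻ {n = y} z∈)))
             ∷ unique-members a y
    y∷members⊆S : ∀ {z} → z ∈ y ∷ members a y → z ∈ S
    y∷members⊆S (here refl) = covers a~y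
    y∷members⊆S (there z∈)  = covers (proj₂ (∈-members⁻ {n = y} z∈))

  -- The cycle of a contains the count a y elements below y and y itself, while a period t
  -- would confine it to the t elements enum a 0, …, enum a (t - 1).
  cycleLength>count : ∀ {a y} → SameCycle f a y → CycleLengthGreater f a (count a y)
  cycleLength>count {a} {y} a~y with cycleLengthGreater-or-period a (count a y)
  ... | inj₁ long = long
  ... | inj₂ (suc t , _ , t≤count , period) =
    ⊥-elim (<⇒≱ (count-< a~y covers) (subst (_≤ count a y) (sym (length-applyDownFrom (enum a) (suc t))) t≤count))
    where
    covers : ∀ {z} → SameCycle f a z → z ∈ applyDownFrom (enum a) (suc t)
    covers a~z with enum-covers period (sameCycle⇒reach a~z)
    ... | i , i<t , refl = ∈-applyDownFrom⁺ (enum a) i<t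

  g : ℕ → ℕ
  g y = enum (root y) (count (root y) y)

  sameCycle-g : ∀ y → SameCycle f y (g y)
  sameCycle-g y = sameCycle-trans (root-sameCycle y) (sameCycle-enum (root y) (count (root y) y))

  private
    root-of-member : ∀ {a y} → SameCycle f a y → root a ≡ a → root y ≡ a
    root-of-member a~y root-a = trans (sym (root-cong a~y)) root-a

    root-root : ∀ x → root (root x) ≡ root x
    root-root x = sym (root-cong (root-sameCycle x))

  g-on-cycle : ∀ {a y} → SameCycle f a y → root a ≡ a → g y ≡ enum a (count a y)
  g-on-cycle {a} {y} a~y root-a = cong (λ r → enum r (count r y)) (root-of-member a~y root-a)

  g-collision : ∀ y y' → g y ≡ g y' → SameCycle f (root y) y' × count (root y) y ≡ count (root y) y'
  g-collision y y' gy≡gy' = a~y' , enum-injective (cycleLength>count a~y) (cycleLength>count a~y')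
    (trans (sym (g-on-cycle a~y (root-root y))) (trans gy≡gy' (g-on-cycle a~y' (root-root y))))
    where
    a~y : SameCycle f (root y) y
    a~y = sameCycle-sym (root-sameCycle y)
    a~y' : SameCycle f (root y) y'
    a~y' = sameCycle-trans a~y (sameCycle-trans (sameCycle-g y)
             (subst (λ v → SameCycle f v y') (sym gy≡gy') (sameCycle-sym (sameCycle-g y'))))

  g-injective : ∀ {y y'} → g y ≡ g y' → y ≡ y'
  g-injective {y} {y'} gy≡gy' = by-order (g-collision y y' gy≡gy') (<-cmp y y')
    where
    by-order : SameCycle f (root y) y' × count (root y) y ≡ count (root y) y' →
               Tri (y < y') (y ≡ y') (y' < y) → y ≡ y'
    by-order _             (tri≈ _ y≡y' _) = y≡y'
    by-order (_ , same)    (tri< y<y' _ _) = ⊥-elim (<-irrefl same (count-strict (sameCycle-sym (root-sameCycle y)) y<y'))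
    by-order (a~y' , same) (tri> _ _ y'<y) = ⊥-elim (<-irrefl (sym same) (count-strict a~y' y'<y))

  count-reaches : ∀ a J → CycleLengthGreater f a J → Σ ℕ λ y → SameCycle f a y × count a y ≡ J
  count-reaches a J long = count-intermediate a N J (≤-trans (≤-reflexive (sym (length-applyDownFrom (enum a) (suc J))))
                                                             (count-≥ unique bounded))
    where
    enums : List ℕ
    enums = applyDownFrom (enum a) (suc J)
    N : ℕ
    N = suc (sum enums)
    unique : Unique enums
    unique = Unique.applyDownFrom⁺₁ (enum a) (suc J) λ j<i i<1+J e →
      <-irrefl (sym (enum-injective (CycleLengthGreater-≤ (s≤s⁻¹ i<1+J) long)
                                    (CycleLengthGreater-≤ (<⇒≤ (≤-trans j<i (s≤s⁻¹ i<1+J))) long) e)) j<i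
    bounded : ∀ {z} → z ∈ enums → z < N × SameCycle f a z
    bounded z∈ with ∈-applyDownFrom⁻ (enum a) z∈
    ... | i , _ , refl = s≤s (∈⇒≤sum z∈) , sameCycle-enum a i

  g-surjective : ∀ x → Σ ℕ λ y → g y ≡ x
  g-surjective x with enum-index (sameCycle-sym (root-sameCycle x))
  ... | J , enum≡x , long with count-reaches (root x) J long
  ... | y , a~y , count≡J = y , trans (g-on-cycle a~y (root-root x)) (trans (cong (enum (root x)) count≡J) enum≡x)

  opaque
    h : ℕ → ℕ
    h x = proj₁ (g-surjective x)

    g∘h : ∀ x → g (h x) ≡ x
    g∘h x = proj₂ (g-surjective x)

  h∘g : ∀ y → h (g y) ≡ y
  h∘g y = g-injective (g∘h (g y))

  normaliser : Perm
  normaliser = record { fun = h ; inv = g ; inv-fun = g∘h ; fun-inv = h∘g }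

  normalForm : Perm
  normalForm = conjugate normaliser f

  normalForm-samePart : SamePart normalForm f
  normalForm-samePart = conjugate-samePart normaliser f sameCycle-g

  g-least : ∀ {a} → LeastInCycle f a → g a ≡ a
  g-least {a} least = trans (g-on-cycle (sameCycle-refl a) (root-least least)) (cong (enum a) (count-least least))

  count-h-enum : ∀ {a m} → LeastInCycle f a → CycleLengthGreater f a m →
                 ∀ i → i ≤ m → count a (h (enum a i)) ≡ i
  count-h-enum {a} least long i i≤m = enum-injective (cycleLength>count a~y) (CycleLengthGreater-≤ i≤m long)
    (trans (sym (g-on-cycle a~y (root-least least))) (g∘h (enum a i)))
    where
    a~y : SameCycle f a (h (enum a i))
    a~y = sameCycle-trans (sameCycle-enum a i)
            (subst (λ v → SameCycle f v (h (enum a i))) (g∘h (enum a i)) (sameCycle-sym (sameCycle-g (h (enum a i)))))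

  normalForm-normal : IsNormal normalForm
  normalForm-normal a least' j long' = subst₂ _<_ (sym (position j)) (sym (position (suc j))) increasing
    where
    least : LeastInCycle f a
    least y a~y = least' y (Equivalence.from (normalForm-samePart a y) a~y)
    long : CycleLengthGreater f a (suc j)
    long = conjugate-cycleLength normaliser f (g-least least) long'
    position : ∀ i → pow normalForm (δinv i) a ≡ h (enum a i)
    position i = trans (pow-conjugate normaliser f (δinv i) a) (cong (λ v → h (pow f (δinv i) v)) (g-least least))
    increasing : h (enum a j) < h (enum a (suc j))
    increasing = ≰⇒> λ le → <⇒≱ (n<1+n j)
      (subst₂ _≤_ (count-h-enum least long (suc j) ≤-refl) (count-h-enum least long j (n≤1+n j)) (count-mono a le))

module NormalisationPrograms (f : Perm) {e : ℕ} (rF : Realises nat nat e (fun f)) (d : ℕ) (decides : DecidesPart f d) where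
  open Orbits f
  open Normalisation f d decides

  χᴿ : Realises (nat ⊗ nat) nat d (λ (x , y) → χ x y)
  χᴿ = realise λ (x , y) → χ-eval x y

  rootᵖ countᵖ gᵖ hᵖ normalFormᵖ : ℕ
  rootᵖ       = μᵖ (d ▹ isZeroᵖ)
  countᵖ      = recᵖ zeroᵖ (⟨ ⟨ fstᵖ , sndᵖ ▹ fstᵖ ⟩ᵖ ▹ d , sndᵖ ▹ sndᵖ ⟩ᵖ ▹ addᵖ)
  gᵖ          = ⟨ rootᵖ , ⟨ rootᵖ , idᵖ ⟩ᵖ ▹ countᵖ ⟩ᵖ ▹ enumᵖ e (inverseᵖ e)
  hᵖ          = inverseᵖ gᵖ
  normalFormᵖ = gᵖ ▹ e ▹ hᵖ

  rootᴿ : Realises nat nat rootᵖ root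
  rootᴿ = μᴿ (▹ᴿ χᴿ isZeroᴿ) root found earlier
    where
    found : ∀ x → 1 ∸ χ x (root x) ≡ 0
    found x = cong (1 ∸_) (χ-same (root-sameCycle x))
    earlier : ∀ x i → i < root x → 1 ∸ χ x i ≢ 0
    earlier x i i<root vanishes =
      1+n≢0 (trans (sym (cong (1 ∸_) (χ-other λ x~i → <⇒≱ i<root (root-≤ x~i)))) vanishes)

  countᴿ : Realises (nat ⊗ nat) nat countᵖ (λ (a , n) → count a n)
  countᴿ = Realises-cong (λ (a , n) → primRec-count a n)
    (recᴿ zeroᴿ (▹ᴿ {ey = nat ⊗ nat} (pairᴿ (▹ᴿ {ey = nat ⊗ nat} (pairᴿ fstᴿ second) χᴿ) thirdᴿ) addᴿ))
    where
    second : Realises (nat ⊗ nat ⊗ nat) nat (sndᵖ ▹ fstᵖ) (λ (_ , n , _) → n)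
    second = ▹ᴿ {ey = nat ⊗ nat} sndᴿ fstᴿ
    primRec-count : ∀ a n → primRec (λ _ → 0) (λ (a , n , r) → χ a n + r) (a , n) ≡ count a n
    primRec-count a zero    = refl
    primRec-count a (suc n) = cong (λ r → χ a n + r) (primRec-count a n)

  gᴿ : Realises nat nat gᵖ g
  gᴿ = ▹ᴿ {ey = nat ⊗ nat} (pairᴿ rootᴿ (▹ᴿ {ey = nat ⊗ nat} (pairᴿ rootᴿ idᴿ) countᴿ))
         (enumᴿ f rF (inverseᴿ rF (inv-fun f) (fun-inv f)))

  hᴿ : Realises nat nat hᵖ h
  hᴿ = inverseᴿ gᴿ h∘g g∘h

  normalFormᴿ : Realises nat nat normalFormᵖ (fun normalForm)
  normalFormᴿ = ▹ᴿ (▹ᴿ gᴿ rF) hᴿ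

EffectivelyConjugateToNormalForm : Perm → Set
EffectivelyConjugateToNormalForm f =
  Σ Perm λ f' → IsNormal f' × SamePart f' f × InG f' ×
    Σ Perm λ h → InG h × (∀ x → fun f x ≡ inv h (fun f' (fun h x)))

partDecidable⇒conjugateToNormalForm : ∀ f → InG f → PartDecidable f → EffectivelyConjugateToNormalForm f
partDecidable⇒conjugateToNormalForm f (e , ce) (d , decides) =
  normalForm , normalForm-normal , normalForm-samePart , (normalFormᵖ , run normalFormᴿ) ,
  normaliser , (hᵖ , run hᴿ) , conjugate-unconjugate normaliser f
  where
  open Normalisation f d decides
  open NormalisationPrograms f (realise ce) d decides

conjugateToNormalForm⇒partDecidable : ∀ f → EffectivelyConjugateToNormalForm f → PartDecidable f
conjugateToNormalForm⇒partDecidable f (f' , normal , same , (e , ce) , _) =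
  ⟦ deciderᶜ ⟧ e , normal-form-decides f f' normal same e ce

compiled-decider : ∀ (f f' : Perm) → IsNormal f' → SamePart f' f → ∀ e → Computes e (fun f') →
                   Σ ℕ λ d → Eval (compile deciderᶜ) e d × DecidesPart f d
compiled-decider f f' normal same e ce =
  ⟦ deciderᶜ ⟧ e , run (compile-realises deciderᶜ) e , normal-form-decides f f' normal same e ce

theorem3p12 :
    ((f : Perm) → InG f →
      PartDecidable f ⇔
        (Σ Perm λ f' → IsNormal f' × SamePart f' f × InG f' ×
          Σ Perm λ h → InG h × (∀ x → fun f x ≡ inv h (fun f' (fun h x)))))
    ×
    (∃ λ c → (f f' : Perm) → InG f → IsNormal f' → SamePart f' f →
      (e : ℕ) → Computes e (fun f') →
      Σ ℕ λ d → Eval c e d × DecidesPart f d)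
theorem3p12 =
  (λ f inG → mk⇔ (partDecidable⇒conjugateToNormalForm f inG) (conjugateToNormalForm⇒partDecidable f)) ,
  compile deciderᶜ , λ f f' _ → compiled-decider f f'
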